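{- The following hold (where $\mathcal M\le\mathcal N$ means there is a minion homomorphism $\mathcal M\to\mathcal N$): $\mathcal D_\infty\le\mathcal C_\infty\le\mathcal B_\infty$; $\mathcal B_\infty\le\mathcal B_k$ for all $k\in\mathbb N$; $\mathcal B_{k+1}\le\mathcal A_{k+1}\le\mathcal B_k\le\mathcal A_k\le\mathcal T$ for all $k\in\mathbb N$; $\mathcal C_\infty\le\mathcal C_k$ for all $k\ge 2$; $\mathcal C_{k+1}\le\mathcal D_k\le\mathcal C_k$ for all $k\ge2$, and $\mathcal C_2\le\mathcal D_1$; $\mathcal C_{k+1}\le\mathcal B_k$ and $\mathcal D_k\le\mathcal A_k$ for all $k\in\mathbb N$.
   Context: A minion homomorphism between sets of multisorted operations closed under minors is a family of arity-preserving maps $\xi^{(n)}$ with $\xi(\mathbf f^{(\alpha)})=\xi(\mathbf f)^{(\alpha)}$, where $f^{(\alpha)}_i(a_1,\dots,a_m)=f_i(a_{\alpha(1)},\dots,a_{\alpha(n)})$ for $\alpha:[n]\to[m]$. $\mathcal T$ is the clone of all operations on a one-element set. For $n$-ary Boolean $f,g$: $f\le g$ pointwise; $f\triangleleft g$ iff $f(\mathbf a)\le g(\mathbf b)$ whenever $\mathbf a\le\mathbf b$; $f^d(\mathbf a)=1-f(\overline{\mathbf a})$. $\mathcal I_k$ is the set of $k$-tuples of $n$-ary idempotent Boolean operations ($n\in\mathbb N$). Chains mean consecutive relations hold. $\mathcal A_k=\{\mathbf h\in\mathcal I_k: h_1\triangleleft\dots\triangleleft h_k\le h_k^d\}$; $\mathcal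 B_k=\{\mathbf h\in\mathcal I_k: h_1\triangleleft\dots\triangleleft h_k\triangleleft h_k^d\}$; $\mathcal C_k=\{\mathbf h\in\mathcal I_k: h_1\triangleleft\dots\triangleleft h_{k-1}\le h_k=h_k^d,\ h_{k-1}\triangleleft h_{k-1}^d\}$ ($k\ge2$); $\mathcal D_k=\{\mathbf h\in\mathcal I_k: h_1\triangleleft\dots\triangleleft h_k=h_k^d\}$; $\mathcal B_\infty=\{(h)\in\mathcal I_1: h\triangleleft h\triangleleft h^d\}$; $\mathcal C_\infty=\{(h_1,h_2)\in\mathcal I_2: h_1\triangleleft h_1\triangleleft h_2=h_2^d\}$; $\mathcal D_\infty=\{(h)\in\mathcal I_1: h\triangleleft h=h^d\}$. -}

module Defs where

open import Data.Nat using (ℕ; zero; suc; _+_; _<_)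
open import Data.Fin using (Fin; toℕ)
open import Data.Bool using (Bool; true; false; not)
import Data.Bool as B
open import Data.Unit using (⊤)
open import Data.Product using (_×_; Σ; _,_)
open import Function using (_∘_)
open import Relation.Binary.PropositionalEquality using (_≡_)

record Minion : Set₁ where
  field
    Carrier : ℕ → Set
    _≈_     : ∀ {n} → Carrier n → Carrier n → Set
    minor   : ∀ {n m} → (Fin n → Fin m) → Carrier n → Carrier m

-- A set of elements of a minion (assumed closed under minors, as in the paper)
record SubMinion : Set₁ where
  field
    minion : Minion
    member : ∀ {n} → Minion.Carrier minion n → Set

record MinionHom (𝓜 𝓝 : SubMinion) : Set where
  open SubMinion 𝓜 renaming (minion to M; member to inM)
  open SubMinion 𝓝 renaming (minion to N; member to inN)
  open Minion M renaming (Carrier to CM; _≈_ to _≈M_; minor to minorM)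
  open Minion N renaming (Carrier to CN; _≈_ to _≈N_; minor to minorN)
  field
    ξ       : ∀ {n} (f : CM n) → inM f → CN n
    ξ-into  : ∀ {n} (f : CM n) (p : inM f) → inN (ξ f p)
    ξ-resp  : ∀ {n} (f g : CM n) (p : inM f) (q : inM g) →
              f ≈M g → ξ f p ≈N ξ g q
    ξ-minor : ∀ {n m} (α : Fin n → Fin m) (f : CM n) (p : inM f)
              (q : inM (minorM α f)) →
              ξ (minorM α f) q ≈N minorN α (ξ f p)

_≼_ : SubMinion → SubMinion → Set
𝓜 ≼ 𝓝 = MinionHom 𝓜 𝓝

Op : ℕ → Set
Op n = (Fin n → Bool) → Bool

minorOp : ∀ {n m} → (Fin n → Fin m) → Op n → Op m
minorOp α f a = f (a ∘ α)

_≈ₒ_ : ∀ {n} → Op n → Op n → Set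
f ≈ₒ g = ∀ a → f a ≡ g a

_≤ₒ_ : ∀ {n} → Op n → Op n → Set
f ≤ₒ g = ∀ a → f a B.≤ g a

_≤ᵥ_ : ∀ {n} → (Fin n → Bool) → (Fin n → Bool) → Set
a ≤ᵥ b = ∀ i → a i B.≤ b i

_◁_ : ∀ {n} → Op n → Op n → Set
f ◁ g = ∀ a b → a ≤ᵥ b → f a B.≤ g b

dual : ∀ {n} → Op n → Op n
dual f a = not (f (not ∘ a))

Idempotent : ∀ {n} → Op n → Set
Idempotent f = ∀ b → f (λ _ → b) ≡ b

Tup : ℕ → ℕ → Set
Tup k n = Fin k → Op n

OpMinion : ℕ → Minion
OpMinion k = record
  { Carrier = Tup k
  ; _≈_     = λ h h' → ∀ i → h i ≈ₒ h' i
  ; minor   = λ α h i → minorOp α (h i)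
  }

𝒯 : SubMinion
𝒯 = record
  { minion = record
      { Carrier = λ n → (Fin n → ⊤) → ⊤
      ; _≈_     = λ f g → ∀ a → f a ≡ g a
      ; minor   = λ α f a → f (a ∘ α)
      }
  ; member = λ _ → ⊤
  }

AllIdem : ∀ {k n} → Tup k n → Set
AllIdem h = ∀ i → Idempotent (h i)

Succ : ∀ {k} → Fin k → Fin k → Set
Succ i j = toℕ j ≡ suc (toℕ i)

IsLast : ∀ {k} → Fin k → Set
IsLast {k} i = suc (toℕ i) ≡ k

Chain◁ : ∀ {k n} → Tup k n → Set
Chain◁ h = ∀ i j → Succ i j → h i ◁ h j

Chain◁Init : ∀ {k n} → Tup k n → Set
Chain◁Init {k} h = ∀ i j → Succ i j → suc (toℕ j) < k → h i ◁ h j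

mkSub : (k : ℕ) → (∀ {n} → Tup k n → Set) → SubMinion
mkSub k P = record { minion = OpMinion k ; member = P }

𝒜 : ℕ → SubMinion
𝒜 k = mkSub k (λ h → AllIdem h × Chain◁ h ×
                   (∀ i → IsLast i → h i ≤ₒ dual (h i)))

ℬ : ℕ → SubMinion
ℬ k = mkSub k (λ h → AllIdem h × Chain◁ h ×
                   (∀ i → IsLast i → h i ◁ dual (h i)))

𝒞 : ℕ → SubMinion
𝒞 k = mkSub k (λ h → AllIdem h × Chain◁Init h ×
                   (∀ i j → Succ i j → IsLast j →
                      (h i ≤ₒ h j) × (h j ≈ₒ dual (h j)) × (h i ◁ dual (h i))))

𝒟 : ℕ → SubMinion
𝒟 k = mkSub k (λ h → AllIdem h × Chain◁ h ×
                   (∀ i → IsLast i → h i ≈ₒ dual (h i)))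

private
  z1 : Fin 1
  z1 = Fin.zero
  z2 o2 : Fin 2
  z2 = Fin.zero
  o2 = Fin.suc Fin.zero

ℬ∞ : SubMinion
ℬ∞ = mkSub 1 (λ h → AllIdem h × (h z1 ◁ h z1) × (h z1 ◁ dual (h z1)))

𝒞∞ : SubMinion
𝒞∞ = mkSub 2 (λ h → AllIdem h × (h z2 ◁ h z2) × (h z2 ◁ h o2) ×
                    (h o2 ≈ₒ dual (h o2)))

𝒟∞ : SubMinion
𝒟∞ = mkSub 1 (λ h → AllIdem h × (h z1 ◁ h z1) × (h z1 ≈ₒ dual (h z1)))

-- Every homomorphism here forgets or repeats components: it sends h to h ∘ σ for a map
-- σ between index sets, so it commutes with minors automatically and only membership has
-- to be checked.  That check is pure order-theoretic bookkeeping except for one step: if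
-- f ◁ g ≤ g^d then f ◁ f^d, because for a ≤ b we have f(a) ≤ g(a) ≤ ¬g(ā) ≤ ¬f(b̄).
module Submission where

open import Defs
open import Data.Nat using (ℕ; suc; s≤s; _≤_; _<_; _≟_)
open import Data.Nat.Properties using (<-irrefl; <⇒≢)
open import Data.Fin using (Fin; toℕ; inject₁; fromℕ) renaming (zero to fz; suc to fs)
open import Data.Fin.Properties using (toℕ<n; toℕ-inject₁; toℕ-fromℕ)
open import Data.Bool using (Bool; not; b≤b; f≤t)
import Data.Bool as B
open import Data.Bool.Properties using ()
  renaming (≤-trans to ≤ᵇ-trans; ≤-refl to ≤ᵇ-refl; ≤-reflexive to ≤ᵇ-reflexive)
open import Data.Product using (_×_; _,_; proj₁; proj₂)
open import Data.Unit using (tt)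
open import Data.Empty using (⊥-elim)
open import Function using (_∘_)
open import Relation.Nullary using (yes; no; ¬_)
open import Relation.Binary.PropositionalEquality using (_≡_; refl; sym; trans; subst; cong)

not-antitone : ∀ {x y : Bool} → x B.≤ y → not y B.≤ not x
not-antitone f≤t = f≤t
not-antitone b≤b = b≤b

module _ {n : ℕ} where

  ◁-≤-trans : {f g h : Op n} → f ◁ g → g ≤ₒ h → f ◁ h
  ◁-≤-trans f◁g g≤h a b a≤b = ≤ᵇ-trans (f◁g a b a≤b) (g≤h b)

  ◁⇒≤ : {f g : Op n} → f ◁ g → f ≤ₒ g
  ◁⇒≤ f◁g a = f◁g a a (λ _ → ≤ᵇ-refl)

  ≈⇒≤ : {f g : Op n} → f ≈ₒ g → f ≤ₒ g
  ≈⇒≤ f≈g a = ≤ᵇ-reflexive (f≈g a)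

  ◁-≤-dual⇒◁-dual : {f g : Op n} → f ◁ g → g ≤ₒ dual g → f ◁ dual f
  ◁-≤-dual⇒◁-dual {f} {g} f◁g g≤gᵈ a b a≤b =
    ≤ᵇ-trans (◁⇒≤ f◁g a)
      (≤ᵇ-trans (g≤gᵈ a)
        (not-antitone (f◁g (not ∘ b) (not ∘ a) (λ i → not-antitone (a≤b i)))))

≼𝒯 : ∀ 𝓜 → 𝓜 ≼ 𝒯
≼𝒯 𝓜 = record
  { ξ       = λ _ _ _ → tt
  ; ξ-into  = λ _ _ → tt
  ; ξ-resp  = λ _ _ _ _ _ _ → refl
  ; ξ-minor = λ _ _ _ _ _ → refl
  }

≼-reindex : ∀ {k l} {P : ∀ {n} → Tup k n → Set} {Q : ∀ {n} → Tup l n → Set}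
  (σ : Fin l → Fin k) →
  (∀ {n} (h : Tup k n) → P h → Q (λ i → h (σ i))) → mkSub k P ≼ mkSub l Q
≼-reindex σ P⇒Q = record
  { ξ       = λ h _ i → h (σ i)
  ; ξ-into  = P⇒Q
  ; ξ-resp  = λ _ _ _ _ f≈g i → f≈g (σ i)
  ; ξ-minor = λ _ _ _ _ _ _ → refl
  }

≼-weaken : ∀ {k} {P Q : ∀ {n} → Tup k n → Set} →
  (∀ {n} (h : Tup k n) → P h → Q h) → mkSub k P ≼ mkSub k Q
≼-weaken = ≼-reindex (λ i → i)

Succ⇒¬IsLast : ∀ {k} (i j : Fin k) → Succ i j → ¬ IsLast i
Succ⇒¬IsLast {k} i j i→j i-last =
  <-irrefl refl (subst (_< k) (trans i→j i-last) (toℕ<n j))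

Succ-inject₁ : ∀ {k} (i j : Fin k) → Succ i j → Succ (inject₁ i) (inject₁ j)
Succ-inject₁ i j i→j rewrite toℕ-inject₁ i | toℕ-inject₁ j = i→j

Succ-inject₁-fromℕ : ∀ {k} (i : Fin k) → IsLast i → Succ (inject₁ i) (fromℕ k)
Succ-inject₁-fromℕ {k} i i-last rewrite toℕ-inject₁ i | toℕ-fromℕ k = sym i-last

IsLast-fromℕ : ∀ k → IsLast (fromℕ k)
IsLast-fromℕ k = cong suc (toℕ-fromℕ k)

-- Kept abstract: otherwise the with-clauses unfold in goals and block rewriting by the
-- two equations below.
abstract
  redirectLast : ∀ {k l} → (Fin k → Fin l) → Fin l → Fin k → Fin l
  redirectLast {k} f x i with suc (toℕ i) ≟ k
  ... | yes _ = x
  ... | no _  = f i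

  redirectLast-last : ∀ {k l} (f : Fin k → Fin l) x i → IsLast i → redirectLast f x i ≡ x
  redirectLast-last {k} f x i i-last with suc (toℕ i) ≟ k
  ... | yes _ = refl
  ... | no ¬i-last = ⊥-elim (¬i-last i-last)

  redirectLast-¬last : ∀ {k l} (f : Fin k → Fin l) x i → ¬ IsLast i → redirectLast f x i ≡ f i
  redirectLast-¬last {k} f x i ¬i-last with suc (toℕ i) ≟ k
  ... | yes i-last = ⊥-elim (¬i-last i-last)
  ... | no _ = refl

module _ {k n : ℕ} {h : Tup (suc k) n} where

  Chain◁-inject₁ : Chain◁ h → Chain◁ (λ i → h (inject₁ i))
  Chain◁-inject₁ chain i j i→j = chain (inject₁ i) (inject₁ j) (Succ-inject₁ i j i→j)

  Chain◁Init-inject₁ : Chain◁Init h → Chain◁ (λ i → h (inject₁ i))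
  Chain◁Init-inject₁ chain i j i→j =
    chain (inject₁ i) (inject₁ j) (Succ-inject₁ i j i→j) (suc-toℕ-inject₁< j)
    where
    suc-toℕ-inject₁< : (j : Fin k) → suc (toℕ (inject₁ j)) < suc k
    suc-toℕ-inject₁< j rewrite toℕ-inject₁ j = s≤s (toℕ<n j)

Chain◁⇒Chain◁Init : ∀ {k n} {h : Tup k n} → Chain◁ h → Chain◁Init h
Chain◁⇒Chain◁Init chain i j i→j _ = chain i j i→j

LastLink : ∀ {k n} → Tup k n → Set
LastLink h = ∀ i j → Succ i j → IsLast j →
  (h i ≤ₒ h j) × (h j ≈ₒ dual (h j)) × (h i ◁ dual (h i))

LastLink-fromℕ : ∀ {k n} {h : Tup (suc k) n} → LastLink h → ∀ i → IsLast i →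
  (h (inject₁ i) ≤ₒ h (fromℕ k)) × (h (fromℕ k) ≈ₒ dual (h (fromℕ k)))
  × (h (inject₁ i) ◁ dual (h (inject₁ i)))
LastLink-fromℕ {k} link i i-last =
  link (inject₁ i) (fromℕ k) (Succ-inject₁-fromℕ i i-last) (IsLast-fromℕ k)

𝒟∞≼𝒞∞ : 𝒟∞ ≼ 𝒞∞
𝒟∞≼𝒞∞ = ≼-reindex (λ _ → fz) λ { h (idem , h◁h , h≈hᵈ) →
  (λ _ → idem fz) , h◁h , h◁h , h≈hᵈ }

𝒞∞≼ℬ∞ : 𝒞∞ ≼ ℬ∞
𝒞∞≼ℬ∞ = ≼-reindex (λ _ → fz) λ { h (idem , h₁◁h₁ , h₁◁h₂ , h₂≈h₂ᵈ) →
  (λ _ → idem fz) , h₁◁h₁ , ◁-≤-dual⇒◁-dual h₁◁h₂ (≈⇒≤ h₂≈h₂ᵈ) }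

ℬ∞≼ℬ : ∀ k → ℬ∞ ≼ ℬ k
ℬ∞≼ℬ k = ≼-reindex (λ _ → fz) λ { h (idem , h◁h , h◁hᵈ) →
  (λ _ → idem fz) , (λ _ _ _ → h◁h) , (λ _ _ → h◁hᵈ) }

ℬ≼𝒜 : ∀ k → ℬ k ≼ 𝒜 k
ℬ≼𝒜 k = ≼-weaken λ { h (idem , chain , last) →
  idem , chain , λ i i-last → ◁⇒≤ (last i i-last) }

𝒜-suc≼ℬ : ∀ k → 𝒜 (suc k) ≼ ℬ k
𝒜-suc≼ℬ k = ≼-reindex inject₁ λ { h (idem , chain , last) →
  (λ i → idem (inject₁ i)) , Chain◁-inject₁ chain ,
  λ i i-last → ◁-≤-dual⇒◁-dual (chain _ _ (Succ-inject₁-fromℕ i i-last))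
                          (last (fromℕ k) (IsLast-fromℕ k)) }

𝒟≼𝒜 : ∀ k → 𝒟 k ≼ 𝒜 k
𝒟≼𝒜 k = ≼-weaken λ { h (idem , chain , last) →
  idem , chain , λ i i-last → ≈⇒≤ (last i i-last) }

𝒟≼𝒞 : ∀ k → 𝒟 k ≼ 𝒞 k
𝒟≼𝒞 k = ≼-weaken λ { h (idem , chain , last) →
  idem , Chain◁⇒Chain◁Init chain ,
  λ i j i→j j-last → ◁⇒≤ (chain i j i→j) , last j j-last
                   , ◁-≤-dual⇒◁-dual (chain i j i→j) (≈⇒≤ (last j j-last)) }

𝒞-suc≼ℬ : ∀ k → 𝒞 (suc k) ≼ ℬ k
𝒞-suc≼ℬ k = ≼-reindex inject₁ λ { h (idem , chain , link) →
  (λ i → idem (inject₁ i)) , Chain◁Init-inject₁ chain ,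
  λ i i-last → proj₂ (proj₂ (LastLink-fromℕ link i i-last)) }

𝒞∞≼𝒞 : ∀ k → 𝒞∞ ≼ 𝒞 k
𝒞∞≼𝒞 k = ≼-reindex σ λ { h (idem , h₁◁h₁ , h₁◁h₂ , h₂≈h₂ᵈ) →
  (λ i → idem (σ i)) , chain h h₁◁h₁ , link h h₁◁h₂ h₂≈h₂ᵈ }
  where
  σ : Fin k → Fin 2
  σ = redirectLast (λ _ → fz) (fs fz)

  σ-last : ∀ i → IsLast i → σ i ≡ fs fz
  σ-last = redirectLast-last (λ _ → fz) (fs fz)

  σ-¬last : ∀ i → ¬ IsLast i → σ i ≡ fz
  σ-¬last = redirectLast-¬last (λ _ → fz) (fs fz)

  chain : ∀ {n} (h : Tup 2 n) → h fz ◁ h fz → Chain◁Init (λ i → h (σ i))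
  chain h h₁◁h₁ i j i→j j<k
    rewrite σ-¬last i (Succ⇒¬IsLast i j i→j) | σ-¬last j (<⇒≢ j<k) = h₁◁h₁

  link : ∀ {n} (h : Tup 2 n) → h fz ◁ h (fs fz) → h (fs fz) ≈ₒ dual (h (fs fz)) →
         LastLink (λ i → h (σ i))
  link h h₁◁h₂ h₂≈h₂ᵈ i j i→j j-last
    rewrite σ-¬last i (Succ⇒¬IsLast i j i→j) | σ-last j j-last
    = ◁⇒≤ h₁◁h₂ , h₂≈h₂ᵈ , ◁-≤-dual⇒◁-dual h₁◁h₂ (≈⇒≤ h₂≈h₂ᵈ)

𝒞-suc≼𝒟 : ∀ k → 𝒞 (suc k) ≼ 𝒟 k
𝒞-suc≼𝒟 k = ≼-reindex σ λ { h (idem , chain , link) →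
  (λ i → idem (σ i)) , σ-chain h chain link , σ-last-selfdual h link }
  where
  σ : Fin k → Fin (suc k)
  σ = redirectLast inject₁ (fromℕ k)

  σ-last : ∀ i → IsLast i → σ i ≡ fromℕ k
  σ-last = redirectLast-last inject₁ (fromℕ k)

  σ-¬last : ∀ i → ¬ IsLast i → σ i ≡ inject₁ i
  σ-¬last = redirectLast-¬last inject₁ (fromℕ k)

  σ-chain : ∀ {n} (h : Tup (suc k) n) → Chain◁Init h → LastLink h → Chain◁ (λ i → h (σ i))
  σ-chain h chain link i j i→j with suc (toℕ j) ≟ k
  ... | yes j-last rewrite σ-¬last i (Succ⇒¬IsLast i j i→j) | σ-last j j-last
    = ◁-≤-trans (Chain◁Init-inject₁ chain i j i→j) (proj₁ (LastLink-fromℕ link j j-last))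
  ... | no ¬j-last rewrite σ-¬last i (Succ⇒¬IsLast i j i→j) | σ-¬last j ¬j-last
    = Chain◁Init-inject₁ chain i j i→j

  σ-last-selfdual : ∀ {n} (h : Tup (suc k) n) → LastLink h →
    ∀ i → IsLast i → h (σ i) ≈ₒ dual (h (σ i))
  σ-last-selfdual h link i i-last rewrite σ-last i i-last =
    proj₁ (proj₂ (LastLink-fromℕ link i i-last))

theorem4p15 :
    ((𝒟∞ ≼ 𝒞∞) × (𝒞∞ ≼ ℬ∞))
    × (∀ k → 1 ≤ k → ℬ∞ ≼ ℬ k)
    × (∀ k → 1 ≤ k →
         (ℬ (suc k) ≼ 𝒜 (suc k)) × (𝒜 (suc k) ≼ ℬ k) × (ℬ k ≼ 𝒜 k) × (𝒜 k ≼ 𝒯))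
    × (∀ k → 2 ≤ k → 𝒞∞ ≼ 𝒞 k)
    × (∀ k → 2 ≤ k → (𝒞 (suc k) ≼ 𝒟 k) × (𝒟 k ≼ 𝒞 k))
    × (𝒞 2 ≼ 𝒟 1)
    × (∀ k → 1 ≤ k → (𝒞 (suc k) ≼ ℬ k) × (𝒟 k ≼ 𝒜 k))
theorem4p15 =
  (𝒟∞≼𝒞∞ , 𝒞∞≼ℬ∞)
  , (λ k _ → ℬ∞≼ℬ k)
  , (λ k _ → ℬ≼𝒜 (suc k) , 𝒜-suc≼ℬ k , ℬ≼𝒜 k , ≼𝒯 (𝒜 k))
  , (λ k _ → 𝒞∞≼𝒞 k)
  , (λ k _ → 𝒞-suc≼𝒟 k , 𝒟≼𝒞 k)
  , 𝒞-suc≼𝒟 1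
  , (λ k _ → 𝒞-suc≼ℬ k , 𝒟≼𝒜 k)
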